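{- Let $(G,f,\pi)$ be a monotone SDS. Then each of the states $\mathbf{0}=[0,\dots,0]$ and $\mathbf{1}=[1,\dots,1]$ is either a Garden-of-Eden state that reaches a fixed point, or a fixed point.
   Context: Let $G$ be a simple graph with vertex set $\{1,\dots,n\}$, each vertex having a state in $\mathbb{F}_2=\{0,1\}$; states are elements of $\mathbb{F}_2^n$. Each vertex $i$ has a local function $f_i$ of the states of $i$ and its neighbours; its inflation $F_i:\mathbb{F}_2^n\to\mathbb{F}_2^n$ replaces coordinate $i$ by this value and fixes other coordinates. For an update schedule (permutation) $\pi=\pi_1\cdots\pi_n$, $F_\pi=F_{\pi_n}\circ\cdots\circ F_{\pi_1}$; $(G,f,\pi)$ is an SDS. Order $\mathbb{F}_2^n$ componentwise with $0<1$; the SDS is monotone if each $f_i$ is monotone. $X$ is a Garden-of-Eden state if no $Y$ satisfies $F_\pi(Y)=X$; $X$ is a fixed point if $F_\pi(X)=X$; $X$ reaches a fixed point if $F_\pi^m(X)$ is a fixed point for some $m\ge0$. -}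

module Defs where

open import Data.Nat using (ℕ; zero; suc)
open import Data.Bool using (Bool; true; false; if_then_else_; _≤_)
open import Data.Fin using (Fin)
open import Data.Fin.Properties using (_≟_)
open import Data.Fin.Permutation using (Permutation′; _⟨$⟩ʳ_)
open import Data.List using (List; []; _∷_; map; allFin)
open import Data.Product using (Σ; ∃; _×_)
open import Data.Sum using (_⊎_)
open import Relation.Nullary using (¬_; does)
open import Relation.Binary.PropositionalEquality using (_≡_; _≢_)

-- States: elements of F₂ⁿ, as functions Fin n → Bool (false = 0, true = 1).
State : ℕ → Set
State n = Fin n → Bool

_≈ₛ_ : ∀ {n} → State n → State n → Set
X ≈ₛ Y = ∀ j → X j ≡ Y j

_≤ₛ_ : ∀ {n} → State n → State n → Set
X ≤ₛ Y = ∀ j → X j ≤ Y j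

zeroState : ∀ {n} → State n
zeroState _ = false

oneState : ∀ {n} → State n
oneState _ = true

record Graph (n : ℕ) : Set₁ where
  field
    Adj     : Fin n → Fin n → Set
    sym     : ∀ {i j} → Adj i j → Adj j i
    irrefl  : ∀ {i} → ¬ Adj i i

InBall : ∀ {n} → Graph n → Fin n → Fin n → Set
InBall G i j = (j ≡ i) ⊎ Graph.Adj G i j

record LocalFunctions {n : ℕ} (G : Graph n) : Set where
  field
    fun   : Fin n → State n → Bool
    local : ∀ i (X Y : State n) →
            (∀ j → InBall G i j → X j ≡ Y j) → fun i X ≡ fun i Y

Monotone : ∀ {n} {G : Graph n} → LocalFunctions G → Set
Monotone {n} f = ∀ i (X Y : State n) → X ≤ₛ Y →
                 LocalFunctions.fun f i X ≤ LocalFunctions.fun f i Y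

inflation : ∀ {n} {G : Graph n} → LocalFunctions G → Fin n → State n → State n
inflation f i X j = if does (j ≟ i) then LocalFunctions.fun f i X else X j

applySeq : ∀ {n} {G : Graph n} → LocalFunctions G → List (Fin n) → State n → State n
applySeq f []       X = X
applySeq f (i ∷ is) X = applySeq f is (inflation f i X)

-- The update schedule π₁ ⋯ πₙ given by a permutation (πₖ = π ⟨$⟩ʳ k).
schedule : ∀ {n} → Permutation′ n → List (Fin n)
schedule π = map (π ⟨$⟩ʳ_) (allFin _)

-- The SDS map F_π = F_{πₙ} ∘ ⋯ ∘ F_{π₁}.
sdsMap : ∀ {n} {G : Graph n} → LocalFunctions G → Permutation′ n → State n → State n
sdsMap f π = applySeq f (schedule π)

iterate : ∀ {A : Set} → (A → A) → ℕ → A → A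
iterate F zero    x = x
iterate F (suc m) x = F (iterate F m x)

module _ {n} {G : Graph n} (f : LocalFunctions G) (π : Permutation′ n) where
  IsFixedPoint : State n → Set
  IsFixedPoint X = sdsMap f π X ≈ₛ X

  IsGardenOfEden : State n → Set
  IsGardenOfEden X = ¬ (Σ (State n) λ Y → sdsMap f π Y ≈ₛ X)

  ReachesFixedPoint : State n → Set
  ReachesFixedPoint X = ∃ λ m → IsFixedPoint (iterate (sdsMap f π) m X)

-- F_π is monotone, being a composition of inflations of monotone local functions.
-- Since 0 ≤ F_π 0, the orbit of 0 is an ascending chain in the finite lattice F₂ⁿ, so
-- it stabilises at a fixed point; and if F_π Y = 0 for some Y then F_π 0 ≤ F_π Y = 0,
-- so either 0 is fixed or it has no preimage. The state 1 is the order dual.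
module Submission where

open import Defs
open import Data.Nat using (ℕ; zero; suc; _+_; _<_; z≤n; s≤s) renaming (_≤_ to _≤ℕ_)
open import Data.Nat.Properties as ℕₚ
  using (≤-pred; <-≤-trans; ≤∧≢⇒<; <⇒≱; n≮0; +-mono-≤; +-mono-≤-<)
open import Data.Bool using (Bool; true; false; not; b≤b; f≤t) renaming (_≤_ to _≤ᵇ_)
import Data.Bool as Bool
open import Data.Bool.Properties
  using (≤-minimum; ≤-maximum; ≤-antisym; ≤-trans; ≤-reflexive; not-injective)
open import Data.Fin using () renaming (zero to fzero; suc to fsuc)
import Data.Fin.Properties as Finₚ
open import Data.Fin.Permutation using (Permutation′)
open import Data.List using ([]; _∷_)
open import Data.Product using (_×_; _,_; ∃; Σ)
import Data.Product as Product
open import Data.Sum using (_⊎_; inj₁; inj₂)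
open import Data.Empty using (⊥-elim)
open import Function using (_∘_; id)
open import Relation.Nullary using (¬_; Dec; yes; no; does; contradiction)
open import Relation.Binary.PropositionalEquality using (_≡_; _≢_; refl; sym)

descending-plateau : (a : ℕ → ℕ) → (∀ k → a (suc k) ≤ℕ a k) → ∃ λ m → a (suc m) ≡ a m
descending-plateau a desc = go (a 0) a desc ℕₚ.≤-refl
  where
  go : ∀ b (a : ℕ → ℕ) → (∀ k → a (suc k) ≤ℕ a k) → a 0 ≤ℕ b → ∃ λ m → a (suc m) ≡ a m
  go b a desc a₀≤b with a 1 ℕₚ.≟ a 0
  go b       a desc a₀≤b | yes a₁≡a₀ = 0 , a₁≡a₀
  go zero    a desc a₀≤0 | no a₁≢a₀  = ⊥-elim (n≮0 (<-≤-trans (≤∧≢⇒< (desc 0) a₁≢a₀) a₀≤0))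
  go (suc b) a desc a₀≤b | no a₁≢a₀  =
    Product.map suc id (go b (a ∘ suc) (desc ∘ suc) (≤-pred (<-≤-trans (≤∧≢⇒< (desc 0) a₁≢a₀) a₀≤b)))

≈ₛ-dec : ∀ {n} (X Y : State n) → Dec (X ≈ₛ Y)
≈ₛ-dec X Y = Finₚ.all? (λ j → X j Bool.≟ Y j)

complement : ∀ {n} → State n → State n
complement X = not ∘ X

not-antitone : ∀ {a b} → a ≤ᵇ b → not b ≤ᵇ not a
not-antitone f≤t = f≤t
not-antitone b≤b = b≤b

bitValue : Bool → ℕ
bitValue false = 0
bitValue true  = 1

bitValue-mono : ∀ {a b} → a ≤ᵇ b → bitValue a ≤ℕ bitValue b
bitValue-mono f≤t           = z≤n
bitValue-mono (b≤b {false}) = z≤n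
bitValue-mono (b≤b {true})  = s≤s z≤n

weight : ∀ {n} → State n → ℕ
weight {zero}  X = 0
weight {suc n} X = bitValue (X fzero) + weight (X ∘ fsuc)

weight-mono : ∀ {n} {X Y : State n} → X ≤ₛ Y → weight X ≤ℕ weight Y
weight-mono {zero}  X≤Y = z≤n
weight-mono {suc n} X≤Y = +-mono-≤ (bitValue-mono (X≤Y fzero)) (weight-mono (X≤Y ∘ fsuc))

weight-strict : ∀ {n} {X Y : State n} → X ≤ₛ Y → ∀ j → X j ≢ Y j → weight X < weight Y
weight-strict {X = X} {Y} X≤Y fzero Xj≢Yj with X fzero | Y fzero | X≤Y fzero
... | false | true | f≤t = s≤s (weight-mono (X≤Y ∘ fsuc))
... | _     | _    | b≤b = contradiction refl Xj≢Yj
weight-strict X≤Y (fsuc j) Xj≢Yj =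
  +-mono-≤-< (bitValue-mono (X≤Y fzero)) (weight-strict (X≤Y ∘ fsuc) j Xj≢Yj)

≤ₛ∧weight-≥⇒≈ₛ : ∀ {n} {X Y : State n} → X ≤ₛ Y → weight Y ≤ℕ weight X → X ≈ₛ Y
≤ₛ∧weight-≥⇒≈ₛ {X = X} {Y} X≤Y wY≤wX j with X j Bool.≟ Y j
... | yes Xj≡Yj = Xj≡Yj
... | no  Xj≢Yj = contradiction wY≤wX (<⇒≱ (weight-strict X≤Y j Xj≢Yj))

descending-chain-stabilises : ∀ {n} (s : ℕ → State n) → (∀ k → s (suc k) ≤ₛ s k) →
                              ∃ λ m → s (suc m) ≈ₛ s m
descending-chain-stabilises s desc =
  Product.map id (λ {m} w≡ → ≤ₛ∧weight-≥⇒≈ₛ (desc m) (ℕₚ.≤-reflexive (sym w≡)))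
    (descending-plateau (weight ∘ s) (weight-mono ∘ desc))

ascending-chain-stabilises : ∀ {n} (s : ℕ → State n) → (∀ k → s k ≤ₛ s (suc k)) →
                             ∃ λ m → s (suc m) ≈ₛ s m
ascending-chain-stabilises s asc =
  Product.map id (λ ∁s≈ j → not-injective (∁s≈ j))
    (descending-chain-stabilises (complement ∘ s) (λ k j → not-antitone (asc k j)))

module MonotoneMap {n} (F : State n → State n) (F-mono : ∀ {X Y} → X ≤ₛ Y → F X ≤ₛ F Y) where

  HasPreimage : State n → Set
  HasPreimage X = Σ (State n) λ Y → F Y ≈ₛ X

  OrbitReachesFixedPoint : State n → Set
  OrbitReachesFixedPoint X = ∃ λ m → F (iterate F m X) ≈ₛ iterate F m X

  iterate-ascending : ∀ {X} → X ≤ₛ F X → ∀ k → iterate F k X ≤ₛ iterate F (suc k) X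
  iterate-ascending X≤FX zero    = X≤FX
  iterate-ascending X≤FX (suc k) = F-mono (iterate-ascending X≤FX k)

  iterate-descending : ∀ {X} → F X ≤ₛ X → ∀ k → iterate F (suc k) X ≤ₛ iterate F k X
  iterate-descending FX≤X zero    = FX≤X
  iterate-descending FX≤X (suc k) = F-mono (iterate-descending FX≤X k)

  zeroState-reaches-fixed-point : OrbitReachesFixedPoint zeroState
  zeroState-reaches-fixed-point =
    ascending-chain-stabilises _ (iterate-ascending (λ j → ≤-minimum (F zeroState j)))

  oneState-reaches-fixed-point : OrbitReachesFixedPoint oneState
  oneState-reaches-fixed-point =
    descending-chain-stabilises _ (iterate-descending (λ j → ≤-maximum (F oneState j)))

  zeroState-hasPreimage⇒fixed : HasPreimage zeroState → F zeroState ≈ₛ zeroState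
  zeroState-hasPreimage⇒fixed (Y , FY≈0) j = ≤-antisym
    (≤-trans (F-mono (λ i → ≤-minimum (Y i)) j) (≤-reflexive (FY≈0 j)))
    (≤-minimum _)

  oneState-hasPreimage⇒fixed : HasPreimage oneState → F oneState ≈ₛ oneState
  oneState-hasPreimage⇒fixed (Y , FY≈1) j = ≤-antisym (≤-maximum _)
    (≤-trans (≤-reflexive (sym (FY≈1 j))) (F-mono (λ i → ≤-maximum (Y i)) j))

  zeroState-dichotomy : (¬ HasPreimage zeroState × OrbitReachesFixedPoint zeroState)
                        ⊎ F zeroState ≈ₛ zeroState
  zeroState-dichotomy with ≈ₛ-dec (F zeroState) zeroState
  ... | yes fixed    = inj₂ fixed
  ... | no not-fixed = inj₁ (not-fixed ∘ zeroState-hasPreimage⇒fixed , zeroState-reaches-fixed-point)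

  oneState-dichotomy : (¬ HasPreimage oneState × OrbitReachesFixedPoint oneState)
                       ⊎ F oneState ≈ₛ oneState
  oneState-dichotomy with ≈ₛ-dec (F oneState) oneState
  ... | yes fixed    = inj₂ fixed
  ... | no not-fixed = inj₁ (not-fixed ∘ oneState-hasPreimage⇒fixed , oneState-reaches-fixed-point)

module _ {n} {G : Graph n} (f : LocalFunctions G) (mono : Monotone f) where

  inflation-mono : ∀ i {X Y : State n} → X ≤ₛ Y → inflation f i X ≤ₛ inflation f i Y
  inflation-mono i {X} {Y} X≤Y j with does (j Finₚ.≟ i)
  ... | true  = mono i X Y X≤Y
  ... | false = X≤Y j

  applySeq-mono : ∀ is {X Y : State n} → X ≤ₛ Y → applySeq f is X ≤ₛ applySeq f is Y
  applySeq-mono []       X≤Y = X≤Y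
  applySeq-mono (i ∷ is) X≤Y = applySeq-mono is (inflation-mono i X≤Y)

  sdsMap-mono : ∀ π {X Y : State n} → X ≤ₛ Y → sdsMap f π X ≤ₛ sdsMap f π Y
  sdsMap-mono π = applySeq-mono (schedule π)

proposition3p3 : (n : ℕ) (G : Graph n) (f : LocalFunctions G) (π : Permutation′ n) →
    Monotone f →
    ((IsGardenOfEden f π zeroState × ReachesFixedPoint f π zeroState) ⊎ IsFixedPoint f π zeroState)
    × ((IsGardenOfEden f π oneState × ReachesFixedPoint f π oneState) ⊎ IsFixedPoint f π oneState)
proposition3p3 n G f π mono = zeroState-dichotomy , oneState-dichotomy
  where open MonotoneMap (sdsMap f π) (sdsMap-mono f mono π)
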